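{- Let $j:P\to Q$ be a morphism in $\mathcal J$, let $f:P\to P'$ be any morphism of $\mathbf{rPres}$, and let $j':P'\to Q'$ be the pushout of $j$ along $f$. Then $Q'$ is obtained from $P'$ by an elementary Tietze transformation (with $j'$ the corresponding inclusion), and conversely every elementary Tietze transformation from a reflexive presentation $P'$ to $Q'$ arises (up to isomorphism) as such a pushout of an element of $\mathcal J$.
   Context: A presentation $P$: set $P_1$ of generators, set $P_2\subseteq P_1^*\times P_1^*$ of relations $u\Rightarrow v$ ($P_1^*$ free monoid). A morphism $f:P\to Q$ is a function $f:P_1\to Q_1$ with $f^*(u)\Rightarrow f^*(v)\in Q_2$ for all $u\Rightarrow v\in P_2$. $P$ is reflexive if $u\Rightarrow u\in P_2$ for all $u$; $\mathbf{rPres}$ is the category of reflexive presentations; $\langle\text{gens}\mid\text{rels}\rangle$ denotes the reflexive presentation with these generators, these relations and all $u\Rightarrow u$ (and presentations in $\mathbf{rPres}$ are always understood to contain all reflexivity relations). The elementary Tietze transformations producing $Q$ from $P$ are: (gen) for a new generator $a\notin P_1$ and $u\in P_1^*$, $Q_1=P_1\sqcup\{a\}$, $Q_2=P_2\cup\{u\Rightarrow a\}$; (refl) for $u\in P_1^*$, add $u\Rightarrow u$; (sym) for $u\Rightarrow v\in P_2$, add $v\Rightarrow u$; (trans) for $u\Rightarrow v, v\Rightarrow w\in P_2$, add $u\Rightarrow w$; (ctxt) for $v\Rightarrow v'\in P_2$ and $u,w\in P_1^*$, add $uvw\Rightarrow uv'w$ (in the last four, $Q_1=P_1$). $\mathcal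 J$ is the class of inclusions, for $m,n,p,q\in\mathbb N$, $u=a_1\cdots a_m$, $v=a_{m+1}\cdots a_{m+n}$, $w=a_{m+n+1}\cdots a_{m+n+p}$, $w'=a_{m+n+p+1}\cdots a_{m+n+p+q}$: (1) $\langle a_1..a_m\mid\rangle\hookrightarrow\langle a_1..a_{m+1}\mid u\Rightarrow a_{m+1}\rangle$; (2) $\langle a_1..a_m\mid\rangle\hookrightarrow\langle a_1..a_m\mid u\Rightarrow u\rangle$; (3) $\langle a_1..a_{m+n}\mid u\Rightarrow v\rangle\hookrightarrow\langle a_1..a_{m+n}\mid u\Rightarrow v,v\Rightarrow u\rangle$; (4) $\langle a_1..a_{m+n+p}\mid u\Rightarrow v,v\Rightarrow w\rangle\hookrightarrow\langle a_1..a_{m+n+p}\mid u\Rightarrow v,v\Rightarrow w,u\Rightarrow w\rangle$; (5) $\langle a_1..a_{m+n+p+q}\mid u\Rightarrow v\rangle\hookrightarrow\langle a_1..a_{m+n+p+q}\mid u\Rightarrow v,wuw'\Rightarrow wvw'\rangle$. -}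

module Defs where

open import Data.Nat using (ℕ; zero; suc; _+_; _≤?_; _<?_)
open import Data.Fin using (Fin; toℕ; inject₁; fromℕ)
open import Data.List using (List; []; _∷_; map; _++_; filter; allFin)
open import Data.List.Membership.Propositional using (_∈_)
open import Data.Product using (Σ; _×_; _,_)
open import Data.Sum using (_⊎_)
open import Data.Unit using (⊤; tt)
open import Function using (id; _∘_)
open import Relation.Binary.PropositionalEquality using (_≡_)
open import Relation.Nullary.Decidable using (_×-dec_)
import Data.List.Properties as LP

record RPres : Set₁ where
  field
    Gen    : Set
    Rel    : List Gen → List Gen → Set
    isRefl : ∀ u → Rel u u
open RPres public

record _⇒_ (P Q : RPres) : Set where
  field
    fun  : Gen P → Gen Q
    pres : ∀ u v → Rel P u v → Rel Q (map fun u) (map fun v)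
open _⇒_ public

infixr 9 _∘ₚ_
infix 4 _≈ₚ_

_≈ₚ_ : {P Q : RPres} → P ⇒ Q → P ⇒ Q → Set
f ≈ₚ g = ∀ x → fun f x ≡ fun g x

idₚ : (P : RPres) → P ⇒ P
idₚ P = record { fun = id ; pres = pr }
  where
  pr : ∀ u v → Rel P u v → Rel P (map id u) (map id v)
  pr u v r rewrite LP.map-id u | LP.map-id v = r

_∘ₚ_ : {P Q R : RPres} → Q ⇒ R → P ⇒ Q → P ⇒ R
_∘ₚ_ {P} {Q} {R} g f = record { fun = fun g ∘ fun f ; pres = pr }
  where
  open import Relation.Binary.PropositionalEquality using (subst; sym)
  import Data.List.Properties as LP
  pr : ∀ u v → Rel P u v → Rel R (map (fun g ∘ fun f) u) (map (fun g ∘ fun f) v)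
  pr u v r = subst (λ x → Rel R x (map (fun g ∘ fun f) v)) (sym (LP.map-∘ u))
               (subst (λ y → Rel R (map (fun g) (map (fun f) u)) y) (sym (LP.map-∘ v))
                 (pres g _ _ (pres f u v r)))

IsIso : {P Q : RPres} → P ⇒ Q → Set
IsIso {P} {Q} φ = Σ (Q ⇒ P) λ ψ → (ψ ∘ₚ φ ≈ₚ idₚ P) × (φ ∘ₚ ψ ≈ₚ idₚ Q)

IsPushout : {P Q P' Q' : RPres} → (j : P ⇒ Q) (f : P ⇒ P') (j' : P' ⇒ Q') (g : Q ⇒ Q') → Set₁
IsPushout {P} {Q} {P'} {Q'} j f j' g =
  (j' ∘ₚ f ≈ₚ g ∘ₚ j) ×
  (∀ (R : RPres) (h : Q ⇒ R) (k : P' ⇒ R) → k ∘ₚ f ≈ₚ h ∘ₚ j →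
     Σ (Q' ⇒ R) λ u → (u ∘ₚ j' ≈ₚ k) × (u ∘ₚ g ≈ₚ h) ×
       (∀ (u' : Q' ⇒ R) → u' ∘ₚ j' ≈ₚ k → u' ∘ₚ g ≈ₚ h → u' ≈ₚ u))

⟨_∣_⟩ : (A : Set) → List (List A × List A) → RPres
⟨ A ∣ rs ⟩ = record { Gen = A ; Rel = λ u v → ((u , v) ∈ rs) ⊎ (u ≡ v) ; isRefl = λ u → Data.Sum.inj₂ Relation.Binary.PropositionalEquality.refl }
  where import Data.Sum
        import Relation.Binary.PropositionalEquality

-- seg k s l = the word a_{s+1} ⋯ a_{s+l} in the generators a_1,…,a_k
-- (generator a_i is represented by the index i-1 : Fin k).
seg : (k s l : ℕ) → List (Fin k)
seg k s l = filter (λ i → (s ≤? toℕ i) ×-dec (toℕ i <? s + l)) (allFin k)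

data JArrow : Set where
  J1 : (m : ℕ) → JArrow
  J2 : (m : ℕ) → JArrow
  J3 : (m n : ℕ) → JArrow
  J4 : (m n p : ℕ) → JArrow
  J5 : (m n p q : ℕ) → JArrow

domJ : JArrow → RPres
domJ (J1 m) = ⟨ Fin m ∣ [] ⟩
domJ (J2 m) = ⟨ Fin m ∣ [] ⟩
domJ (J3 m n) = ⟨ Fin (m + n) ∣ (seg (m + n) 0 m , seg (m + n) m n) ∷ [] ⟩
domJ (J4 m n p) = ⟨ Fin (m + n + p) ∣
    (seg (m + n + p) 0 m , seg (m + n + p) m n) ∷
    (seg (m + n + p) m n , seg (m + n + p) (m + n) p) ∷ [] ⟩
domJ (J5 m n p q) = ⟨ Fin (m + n + p + q) ∣
    (seg (m + n + p + q) 0 m , seg (m + n + p + q) m n) ∷ [] ⟩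

codJ : JArrow → RPres
codJ (J1 m) = ⟨ Fin (suc m) ∣ (seg (suc m) 0 m , fromℕ m ∷ []) ∷ [] ⟩
codJ (J2 m) = ⟨ Fin m ∣ (seg m 0 m , seg m 0 m) ∷ [] ⟩
codJ (J3 m n) = ⟨ Fin (m + n) ∣
    (seg (m + n) 0 m , seg (m + n) m n) ∷
    (seg (m + n) m n , seg (m + n) 0 m) ∷ [] ⟩
codJ (J4 m n p) = ⟨ Fin (m + n + p) ∣
    (seg (m + n + p) 0 m , seg (m + n + p) m n) ∷
    (seg (m + n + p) m n , seg (m + n + p) (m + n) p) ∷
    (seg (m + n + p) 0 m , seg (m + n + p) (m + n) p) ∷ [] ⟩
codJ (J5 m n p q) = ⟨ Fin k ∣
    (u , v) ∷ (w ++ u ++ w' , w ++ v ++ w') ∷ [] ⟩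
  where
  k = m + n + p + q
  u = seg k 0 m
  v = seg k m n
  w = seg k (m + n) p
  w' = seg k (m + n + p) q

arrJ : (ι : JArrow) → domJ ι ⇒ codJ ι
arrJ (J1 m) = record { fun = inject₁ ; pres = pr }
  where
  open import Data.Sum using (inj₂)
  open import Relation.Binary.PropositionalEquality using (refl)
  pr : ∀ u v → Rel (domJ (J1 m)) u v → Rel (codJ (J1 m)) (map inject₁ u) (map inject₁ v)
  pr u .u (inj₂ refl) = inj₂ refl
arrJ (J2 m) = record { fun = id ; pres = pr }
  where
  open import Data.Sum using (inj₂)
  open import Relation.Binary.PropositionalEquality using (refl)
  pr : ∀ u v → Rel (domJ (J2 m)) u v → Rel (codJ (J2 m)) (map id u) (map id v)
  pr u .u (inj₂ refl) = inj₂ refl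
arrJ (J3 m n) = record { fun = id ; pres = pr }
  where
  open import Data.Sum using (inj₁; inj₂)
  open import Data.List.Relation.Unary.Any using (here; there)
  open import Relation.Binary.PropositionalEquality using (refl)
  import Data.List.Properties as LP
  open import Relation.Binary.PropositionalEquality using (subst; sym)
  pr : ∀ u v → Rel (domJ (J3 m n)) u v → Rel (codJ (J3 m n)) (map id u) (map id v)
  pr u v r rewrite LP.map-id u | LP.map-id v with r
  ... | inj₁ (here refl) = inj₁ (here refl)
  ... | inj₂ refl = inj₂ refl
arrJ (J4 m n p) = record { fun = id ; pres = pr }
  where
  open import Data.Sum using (inj₁; inj₂)
  open import Data.List.Relation.Unary.Any using (here; there)
  open import Relation.Binary.PropositionalEquality using (refl)
  import Data.List.Properties as LP
  pr : ∀ u v → Rel (domJ (J4 m n p)) u v → Rel (codJ (J4 m n p)) (map id u) (map id v)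
  pr u v r rewrite LP.map-id u | LP.map-id v with r
  ... | inj₁ (here refl) = inj₁ (here refl)
  ... | inj₁ (there (here refl)) = inj₁ (there (here refl))
  ... | inj₂ refl = inj₂ refl
arrJ (J5 m n p q) = record { fun = id ; pres = pr }
  where
  open import Data.Sum using (inj₁; inj₂)
  open import Data.List.Relation.Unary.Any using (here; there)
  open import Relation.Binary.PropositionalEquality using (refl)
  import Data.List.Properties as LP
  pr : ∀ u v → Rel (domJ (J5 m n p q)) u v → Rel (codJ (J5 m n p q)) (map id u) (map id v)
  pr u v r rewrite LP.map-id u | LP.map-id v with r
  ... | inj₁ (here refl) = inj₁ (here refl)
  ... | inj₂ refl = inj₂ refl

data Tietze (P : RPres) : Set where
  tgen   : (u : List (Gen P)) → Tietze P
  trefl  : (u : List (Gen P)) → Tietze P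
  tsym   : (u v : List (Gen P)) → Rel P u v → Tietze P
  ttrans : (u v w : List (Gen P)) → Rel P u v → Rel P v w → Tietze P
  tctxt  : (v v' : List (Gen P)) → Rel P v v' → (u w : List (Gen P)) → Tietze P

addRel : (P : RPres) → List (Gen P) → List (Gen P) → RPres
addRel P s t = record
  { Gen = Gen P
  ; Rel = λ x y → Rel P x y ⊎ ((x ≡ s) × (y ≡ t))
  ; isRefl = λ u → Data.Sum.inj₁ (isRefl P u) }
  where import Data.Sum

addGen : (P : RPres) → List (Gen P) → RPres
addGen P u = record
  { Gen = Gen P ⊎ ⊤
  ; Rel = λ x y →
      (Σ (List (Gen P)) λ x' → Σ (List (Gen P)) λ y' →
          Rel P x' y' × (x ≡ map Data.Sum.inj₁ x') × (y ≡ map Data.Sum.inj₁ y'))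
      ⊎ ((x ≡ map Data.Sum.inj₁ u) × (y ≡ Data.Sum.inj₂ tt ∷ []))
      ⊎ (x ≡ y)
  ; isRefl = λ x → Data.Sum.inj₂ (Data.Sum.inj₂ Relation.Binary.PropositionalEquality.refl) }
  where import Data.Sum
        import Relation.Binary.PropositionalEquality

applyT : (P : RPres) → Tietze P → RPres
applyT P (tgen u) = addGen P u
applyT P (trefl u) = addRel P u u
applyT P (tsym u v _) = addRel P v u
applyT P (ttrans u v w _ _) = addRel P u w
applyT P (tctxt v v' _ u w) = addRel P (u ++ v ++ w) (u ++ v' ++ w)

inclAdd : (P : RPres) (s t : List (Gen P)) → P ⇒ addRel P s t
inclAdd P s t = record { fun = id ; pres = pr }
  where
  open import Data.Sum using (inj₁)
  import Data.List.Properties as LP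
  pr : ∀ u v → Rel P u v → Rel (addRel P s t) (map id u) (map id v)
  pr u v r rewrite LP.map-id u | LP.map-id v = inj₁ r

inclGen : (P : RPres) (u : List (Gen P)) → P ⇒ addGen P u
inclGen P u = record { fun = Data.Sum.inj₁ ; pres = λ x y r →
    Data.Sum.inj₁ (x , y , r , Relation.Binary.PropositionalEquality.refl , Relation.Binary.PropositionalEquality.refl) }
  where import Data.Sum
        import Relation.Binary.PropositionalEquality

inclT : (P : RPres) (T : Tietze P) → P ⇒ applyT P T
inclT P (tgen u) = inclGen P u
inclT P (trefl u) = inclAdd P u u
inclT P (tsym u v _) = inclAdd P v u
inclT P (ttrans u v w _ _) = inclAdd P u w
inclT P (tctxt v v' _ u w) = inclAdd P (u ++ v ++ w) (u ++ v' ++ w)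

-- Each generating inclusion ι adjoins to its domain a single generator or relation,
-- written with the segment words a_{s+1} ⋯ a_{s+l}. Pushing ι out along f adjoins
-- the f-image of that generator or relation to P', which is exactly one elementary
-- Tietze transformation, and every other pushout of ι along f is isomorphic to this
-- one. Conversely, the Tietze transformation built from words u, v, … is the pushout
-- of the matching ι along the morphism sending a_1, …, a_k to the successive letters
-- of the concatenated word, which maps each segment word onto the corresponding u, v, ….

module Submission where

open import Defs
open import Data.Bool using (true; false)
open import Data.Fin using (Fin; inject₁; fromℕ) renaming (zero to fzero; suc to fsuc)
import Data.Fin.Relation.Unary.Top as Top
open Top using (‵fromℕ; ‵inject₁)
open import Data.List using (List; []; _∷_; map; _++_; filter; allFin; tabulate; take; drop; length)
open import Data.List.Properties
  using (++-assoc; ++-identityʳ; length-++; map-++; map-cong; map-∘; map-tabulate; take-[]; drop-[]; filter-≐)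
open import Data.List.Relation.Unary.All as All using (All; []; _∷_)
open import Data.List.Relation.Unary.Any using (here; there)
open import Data.Nat using (ℕ; zero; suc; _+_; s≤s; z≤n; s≤s⁻¹)
open import Data.Product using (Σ; _×_; _,_; proj₁; proj₂)
open import Data.Sum using (_⊎_; inj₁; inj₂)
open import Data.Unit using (⊤; tt)
open import Data.Vec as V using (Vec)
import Data.Vec.Properties as VP
open import Function using (id; _∘_)
open import Relation.Nullary using (does)
open import Relation.Unary using (Pred; Decidable; _≐_)
open import Relation.Binary.PropositionalEquality

filter-map : ∀ {a b p} {A : Set a} {B : Set b} {P : Pred B p} (P? : Decidable P) (f : A → B) (xs : List A) →
             filter P? (map f xs) ≡ map f (filter (P? ∘ f) xs)
filter-map P? f [] = refl
filter-map P? f (x ∷ xs) with does (P? (f x))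
... | true  = cong (f x ∷_) (filter-map P? f xs)
... | false = filter-map P? f xs

filter-tabulate-suc : ∀ {k p q} {P : Pred (Fin (suc k)) p} {Q : Pred (Fin k) q}
  (P? : Decidable P) (Q? : Decidable Q) → (P ∘ fsuc) ≐ Q →
  filter P? (tabulate fsuc) ≡ map fsuc (filter Q? (allFin k))
filter-tabulate-suc {k} P? Q? P∘suc≐Q = begin
  filter P? (tabulate fsuc)                 ≡⟨ cong (filter P?) (map-tabulate id fsuc) ⟨
  filter P? (map fsuc (allFin k))           ≡⟨ filter-map P? fsuc (allFin k) ⟩
  map fsuc (filter (P? ∘ fsuc) (allFin k))  ≡⟨ cong (map fsuc) (filter-≐ (P? ∘ fsuc) Q? P∘suc≐Q (allFin k)) ⟩
  map fsuc (filter Q? (allFin k))           ∎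
  where open ≡-Reasoning

seg-suc-suc : ∀ k s l → seg (suc k) (suc s) l ≡ map fsuc (seg k s l)
seg-suc-suc k s l = filter-tabulate-suc _ _
  ((λ (s≤i , i<s+l) → s≤s⁻¹ s≤i , s≤s⁻¹ i<s+l) , (λ (s≤i , i<s+l) → s≤s s≤i , s≤s i<s+l))

seg-zero-suc : ∀ k l → seg (suc k) 0 (suc l) ≡ fzero ∷ map fsuc (seg k 0 l)
seg-zero-suc k l = cong (fzero ∷_) (filter-tabulate-suc _ _
  ((λ (_ , i<l) → z≤n , s≤s⁻¹ i<l) , (λ (_ , i<l) → z≤n , s≤s i<l)))

seg-zero-zero : ∀ k → seg k 0 0 ≡ []
seg-zero-zero zero    = refl
seg-zero-zero (suc k) = begin
  seg (suc k) 0 0          ≡⟨ filter-tabulate-suc _ _ ((λ ()) , (λ ())) ⟩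
  map fsuc (seg k 0 0)     ≡⟨ cong (map fsuc) (seg-zero-zero k) ⟩
  []                       ∎
  where open ≡-Reasoning

map-seg : ∀ {a} {A : Set a} {k} (h : Fin k → A) (s l : ℕ) → map h (seg k s l) ≡ take l (drop s (tabulate h))
map-seg {k = zero}  h s       l       = sym (trans (cong (take l) (drop-[] s)) (take-[] l))
map-seg {k = suc k} h zero    zero    = cong (map h) (seg-zero-zero (suc k))
map-seg {k = suc k} h zero    (suc l) = begin
  map h (seg (suc k) 0 (suc l))          ≡⟨ cong (map h) (seg-zero-suc k l) ⟩
  h fzero ∷ map h (map fsuc (seg k 0 l))  ≡⟨ cong (h fzero ∷_) (map-∘ (seg k 0 l)) ⟨
  h fzero ∷ map (h ∘ fsuc) (seg k 0 l)    ≡⟨ cong (h fzero ∷_) (map-seg (h ∘ fsuc) 0 l) ⟩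
  h fzero ∷ take l (tabulate (h ∘ fsuc))  ∎
  where open ≡-Reasoning
map-seg {k = suc k} h (suc s) l       = begin
  map h (seg (suc k) (suc s) l)          ≡⟨ cong (map h) (seg-suc-suc k s l) ⟩
  map h (map fsuc (seg k s l))           ≡⟨ map-∘ (seg k s l) ⟨
  map (h ∘ fsuc) (seg k s l)             ≡⟨ map-seg (h ∘ fsuc) s l ⟩
  take l (drop s (tabulate (h ∘ fsuc)))  ∎
  where open ≡-Reasoning

map-seg-inject₁ : ∀ {a} {A : Set a} m (h : Fin (suc m) → A) →
                  map h (seg (suc m) 0 m) ≡ map (h ∘ inject₁) (seg m 0 m)
map-seg-inject₁ zero    h = refl
map-seg-inject₁ (suc m) h = begin
  map h (seg (suc (suc m)) 0 (suc m))               ≡⟨ cong (map h) (seg-zero-suc (suc m) m) ⟩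
  h fzero ∷ map h (map fsuc (seg (suc m) 0 m))        ≡⟨ cong (h fzero ∷_) (map-∘ (seg (suc m) 0 m)) ⟨
  h fzero ∷ map (h ∘ fsuc) (seg (suc m) 0 m)          ≡⟨ cong (h fzero ∷_) (map-seg-inject₁ m (h ∘ fsuc)) ⟩
  h fzero ∷ map (h ∘ fsuc ∘ inject₁) (seg m 0 m)      ≡⟨ cong (h fzero ∷_) (map-∘ (seg m 0 m)) ⟩
  h fzero ∷ map (h ∘ inject₁) (map fsuc (seg m 0 m))  ≡⟨ cong (map (h ∘ inject₁)) (seg-zero-suc m m) ⟨
  map (h ∘ inject₁) (seg (suc m) 0 (suc m))          ∎
  where open ≡-Reasoning

drop-length-++ : ∀ {a} {A : Set a} (xs ys : List A) → drop (length xs) (xs ++ ys) ≡ ys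
drop-length-++ []       ys = refl
drop-length-++ (x ∷ xs) ys = drop-length-++ xs ys

take-length-++ : ∀ {a} {A : Set a} (xs ys : List A) → take (length xs) (xs ++ ys) ≡ xs
take-length-++ []       ys = refl
take-length-++ (x ∷ xs) ys = cong (x ∷_) (take-length-++ xs ys)

tabulate-lookup-toList : ∀ {a} {A : Set a} {k} (xs : Vec A k) → tabulate (V.lookup xs) ≡ V.toList xs
tabulate-lookup-toList V.[]       = refl
tabulate-lookup-toList (x V.∷ xs) = cong (x ∷_) (tabulate-lookup-toList xs)

map-lookup-seg : ∀ {a} {A : Set a} {k} (xs : Vec A k) {s : ℕ} (pre b post : List A) →
  V.toList xs ≡ pre ++ b ++ post → s ≡ length pre → map (V.lookup xs) (seg k s (length b)) ≡ b
map-lookup-seg {k = k} xs pre b post xs≡ refl = begin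
  map (V.lookup xs) (seg k (length pre) (length b))
    ≡⟨ map-seg (V.lookup xs) (length pre) (length b) ⟩
  take (length b) (drop (length pre) (tabulate (V.lookup xs)))
    ≡⟨ cong (take (length b) ∘ drop (length pre)) (trans (tabulate-lookup-toList xs) xs≡) ⟩
  take (length b) (drop (length pre) (pre ++ b ++ post))       ≡⟨ cong (take (length b)) (drop-length-++ pre (b ++ post)) ⟩
  take (length b) (b ++ post)                                  ≡⟨ take-length-++ b post ⟩
  b                                                            ∎
  where open ≡-Reasoning

map-lookup-seg-last : ∀ {a} {A : Set a} {k} (xs : Vec A k) {s : ℕ} (pre b : List A) →
  V.toList xs ≡ pre ++ b → s ≡ length pre → map (V.lookup xs) (seg k s (length b)) ≡ b
map-lookup-seg-last xs pre b xs≡ =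
  map-lookup-seg xs pre b [] (trans xs≡ (cong (pre ++_) (sym (++-identityʳ b))))

toList-++-fromList : ∀ {a} {A : Set a} {k} (xs : Vec A k) (ys : List A) →
                     V.toList (xs V.++ V.fromList ys) ≡ V.toList xs ++ ys
toList-++-fromList xs ys = trans (VP.toList-++ xs (V.fromList ys)) (cong (V.toList xs ++_) (VP.toList∘fromList ys))

module _ {P Q P' : RPres} {j : P ⇒ Q} {f : P ⇒ P'} where

  pushout-endo≈id : {Q' : RPres} {j' : P' ⇒ Q'} {g : Q ⇒ Q'} → IsPushout j f j' g →
                    (φ : Q' ⇒ Q') → φ ∘ₚ j' ≈ₚ j' → φ ∘ₚ g ≈ₚ g → φ ≈ₚ idₚ Q'
  pushout-endo≈id {Q'} {j'} {g} (square , universal) φ φj'≈j' φg≈g x =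
    let _ , _ , _ , unique = universal Q' g j' square
    in trans (unique φ φj'≈j' φg≈g x) (sym (unique (idₚ Q') (λ _ → refl) (λ _ → refl) x))

  pushout-unique : {Q₁ Q₂ : RPres} {j₁ : P' ⇒ Q₁} {g₁ : Q ⇒ Q₁} {j₂ : P' ⇒ Q₂} {g₂ : Q ⇒ Q₂} →
                   IsPushout j f j₁ g₁ → IsPushout j f j₂ g₂ →
                   Σ (Q₁ ⇒ Q₂) λ φ → IsIso φ × (φ ∘ₚ j₁ ≈ₚ j₂)
  pushout-unique {Q₁} {Q₂} {j₁} {g₁} {j₂} {g₂} po₁ po₂
    with proj₂ po₁ Q₂ g₂ j₂ (proj₁ po₂) | proj₂ po₂ Q₁ g₁ j₁ (proj₁ po₁)
  ... | φ , φj₁≈j₂ , φg₁≈g₂ , _ | ψ , ψj₂≈j₁ , ψg₂≈g₁ , _ =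
    φ , (ψ , ψφ≈id , φψ≈id) , φj₁≈j₂
    where
    ψφ≈id : ψ ∘ₚ φ ≈ₚ idₚ Q₁
    ψφ≈id = pushout-endo≈id {j' = j₁} {g = g₁} po₁ (ψ ∘ₚ φ)
      (λ x → trans (cong (fun ψ) (φj₁≈j₂ x)) (ψj₂≈j₁ x))
      (λ x → trans (cong (fun ψ) (φg₁≈g₂ x)) (ψg₂≈g₁ x))
    φψ≈id : φ ∘ₚ ψ ≈ₚ idₚ Q₂
    φψ≈id = pushout-endo≈id {j' = j₂} {g = g₂} po₂ (φ ∘ₚ ψ)
      (λ x → trans (cong (fun φ) (ψj₂≈j₁ x)) (φj₁≈j₂ x))
      (λ x → trans (cong (fun φ) (ψg₂≈g₁ x)) (φg₁≈g₂ x))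

module _ {A B P : RPres} (j : A ⇒ B) (f : A ⇒ P) where

  addRel-pushout : {s t : List (Gen P)} (g : B ⇒ addRel P s t) →
    (∀ b → Σ (Gen A) λ a → fun j a ≡ b) → inclAdd P s t ∘ₚ f ≈ₚ g ∘ₚ j →
    {x y : List (Gen B)} → Rel B x y → map (fun g) x ≡ s → map (fun g) y ≡ t →
    IsPushout j f (inclAdd P s t) g
  addRel-pushout {s} {t} g j-onto square {x} {y} r gx≡s gy≡t = square , universal
    where
    universal : ∀ (R : RPres) (h : B ⇒ R) (k : P ⇒ R) → k ∘ₚ f ≈ₚ h ∘ₚ j →
      Σ (addRel P s t ⇒ R) λ u → (u ∘ₚ inclAdd P s t ≈ₚ k) × (u ∘ₚ g ≈ₚ h) ×
        (∀ (u' : addRel P s t ⇒ R) → u' ∘ₚ inclAdd P s t ≈ₚ k → u' ∘ₚ g ≈ₚ h → u' ≈ₚ u)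
    universal R h k kf≈hj = u , (λ _ → refl) , kg≈h , λ _ u'≈k _ → u'≈k
      where
      kg≈h : ∀ b → fun k (fun g b) ≡ fun h b
      kg≈h b with j-onto b
      ... | a , refl = trans (cong (fun k) (sym (square a))) (kf≈hj a)
      h≡k∘g : ∀ z {w} → map (fun g) z ≡ w → map (fun h) z ≡ map (fun k) w
      h≡k∘g z refl = trans (map-cong (sym ∘ kg≈h) z) (map-∘ z)
      pres-k : ∀ z w → Rel (addRel P s t) z w → Rel R (map (fun k) z) (map (fun k) w)
      pres-k z w (inj₁ r′)           = pres k z w r′
      pres-k _ _ (inj₂ (refl , refl)) = subst₂ (Rel R) (h≡k∘g x gx≡s) (h≡k∘g y gy≡t) (pres h x y r)
      u : addRel P s t ⇒ R
      u = record { fun = fun k ; pres = pres-k }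

  addGen-pushout : {w : List (Gen P)} (g : B ⇒ addGen P w) (b₀ : Gen B) →
    (∀ b → (Σ (Gen A) λ a → fun j a ≡ b) ⊎ b ≡ b₀) →
    inclGen P w ∘ₚ f ≈ₚ g ∘ₚ j → fun g b₀ ≡ inj₂ tt →
    {x : List (Gen B)} → Rel B x (b₀ ∷ []) → map (fun g) x ≡ map inj₁ w →
    IsPushout j f (inclGen P w) g
  addGen-pushout {w} g b₀ cover square gb₀≡new {x} r gx≡w = square , universal
    where
    universal : ∀ (R : RPres) (h : B ⇒ R) (k : P ⇒ R) → k ∘ₚ f ≈ₚ h ∘ₚ j →
      Σ (addGen P w ⇒ R) λ u → (u ∘ₚ inclGen P w ≈ₚ k) × (u ∘ₚ g ≈ₚ h) ×
        (∀ (u' : addGen P w ⇒ R) → u' ∘ₚ inclGen P w ≈ₚ k → u' ∘ₚ g ≈ₚ h → u' ≈ₚ u)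
    universal R h k kf≈hj = u , (λ _ → refl) , ug≈h , unique
      where
      [k,hb₀] : Gen P ⊎ ⊤ → Gen R
      [k,hb₀] (inj₁ p)  = fun k p
      [k,hb₀] (inj₂ tt) = fun h b₀
      ug≈h : ∀ b → [k,hb₀] (fun g b) ≡ fun h b
      ug≈h b with cover b
      ... | inj₁ (a , refl) = trans (cong [k,hb₀] (sym (square a))) (kf≈hj a)
      ... | inj₂ refl       = cong [k,hb₀] gb₀≡new
      hx≡kw : map (fun h) x ≡ map [k,hb₀] (map inj₁ w)
      hx≡kw = trans (map-cong (sym ∘ ug≈h) x) (trans (map-∘ x) (cong (map [k,hb₀]) gx≡w))
      pres-u : ∀ z z′ → Rel (addGen P w) z z′ → Rel R (map [k,hb₀] z) (map [k,hb₀] z′)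
      pres-u _ _ (inj₁ (z , z′ , r′ , refl , refl)) =
        subst₂ (Rel R) (map-∘ z) (map-∘ z′) (pres k z z′ r′)
      pres-u _ _ (inj₂ (inj₁ (refl , refl))) =
        subst (λ v → Rel R v (fun h b₀ ∷ [])) hx≡kw (pres h x (b₀ ∷ []) r)
      pres-u z _ (inj₂ (inj₂ refl)) = isRefl R (map [k,hb₀] z)
      u : addGen P w ⇒ R
      u = record { fun = [k,hb₀] ; pres = pres-u }
      unique : ∀ (u' : addGen P w ⇒ R) → u' ∘ₚ inclGen P w ≈ₚ k → u' ∘ₚ g ≈ₚ h → u' ≈ₚ u
      unique u' u'≈k _     (inj₁ p)  = u'≈k p
      unique u' _    u'g≈h (inj₂ tt) = trans (cong (fun u') (sym gb₀≡new)) (u'g≈h b₀)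

snoc : ∀ {a} {X : Set a} {m} → (Fin m → X) → X → Fin (suc m) → X
snoc {m = zero}  f x fzero    = x
snoc {m = suc m} f x fzero    = f fzero
snoc {m = suc m} f x (fsuc i) = snoc (f ∘ fsuc) x i

snoc-inject₁ : ∀ {a} {X : Set a} {m} (f : Fin m → X) x i → snoc f x (inject₁ i) ≡ f i
snoc-inject₁ f x fzero    = refl
snoc-inject₁ f x (fsuc i) = snoc-inject₁ (f ∘ fsuc) x i

snoc-fromℕ : ∀ {a} {X : Set a} m (f : Fin m → X) x → snoc f x (fromℕ m) ≡ x
snoc-fromℕ zero    f x = refl
snoc-fromℕ (suc m) f x = snoc-fromℕ m (f ∘ fsuc) x

inject₁-or-fromℕ : ∀ {m} (i : Fin (suc m)) → (Σ (Fin m) λ i′ → inject₁ i′ ≡ i) ⊎ i ≡ fromℕ m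
inject₁-or-fromℕ i with Top.view i
... | ‵fromℕ     = inj₂ refl
... | ‵inject₁ i′ = inj₁ (i′ , refl)

module _ {P : RPres} where

  pushout-J1 : ∀ m (f : domJ (J1 m) ⇒ P) {w : List (Gen P)} → map (fun f) (seg m 0 m) ≡ w →
    Σ (codJ (J1 m) ⇒ addGen P w) (IsPushout (arrJ (J1 m)) f (inclGen P w))
  pushout-J1 m f refl =
    g , addGen-pushout (arrJ (J1 m)) f g (fromℕ m) inject₁-or-fromℕ
          (λ i → sym (snoc-inject₁ _ _ i)) (snoc-fromℕ m _ _) (inj₁ (here refl)) gx≡fx
    where
    g-fun : Fin (suc m) → Gen P ⊎ ⊤
    g-fun = snoc (inj₁ ∘ fun f) (inj₂ tt)
    gx≡fx : map g-fun (seg (suc m) 0 m) ≡ map inj₁ (map (fun f) (seg m 0 m))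
    gx≡fx = begin
      map g-fun (seg (suc m) 0 m)             ≡⟨ map-seg-inject₁ m g-fun ⟩
      map (g-fun ∘ inject₁) (seg m 0 m)        ≡⟨ map-cong (snoc-inject₁ (inj₁ ∘ fun f) (inj₂ tt)) (seg m 0 m) ⟩
      map (inj₁ ∘ fun f) (seg m 0 m)           ≡⟨ map-∘ (seg m 0 m) ⟩
      map inj₁ (map (fun f) (seg m 0 m))       ∎
      where open ≡-Reasoning
    g : codJ (J1 m) ⇒ addGen P (map (fun f) (seg m 0 m))
    g = record { fun = g-fun ; pres = λ
      { _ _ (inj₁ (here refl)) → inj₂ (inj₁ (gx≡fx , cong (_∷ []) (snoc-fromℕ m _ _)))
      ; _ _ (inj₂ refl)        → inj₂ (inj₂ refl) } }

  pushout-J2 : ∀ m (f : domJ (J2 m) ⇒ P) {w : List (Gen P)} → map (fun f) (seg m 0 m) ≡ w →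
    Σ (codJ (J2 m) ⇒ addRel P w w) (IsPushout (arrJ (J2 m)) f (inclAdd P w w))
  pushout-J2 m f refl =
    g , addRel-pushout (arrJ (J2 m)) f g (λ b → b , refl) (λ _ → refl)
          (inj₁ (here refl)) refl refl
    where
    g : codJ (J2 m) ⇒ addRel P (map (fun f) (seg m 0 m)) (map (fun f) (seg m 0 m))
    g = record { fun = fun f ; pres = λ
      { _ _ (inj₁ (here refl)) → inj₂ (refl , refl)
      ; _ _ (inj₂ refl)        → inj₁ (isRefl P _) } }

  pushout-J3 : ∀ m n (f : domJ (J3 m n) ⇒ P) {u v : List (Gen P)} →
    map (fun f) (seg (m + n) 0 m) ≡ u → map (fun f) (seg (m + n) m n) ≡ v →
    Σ (codJ (J3 m n) ⇒ addRel P v u) (IsPushout (arrJ (J3 m n)) f (inclAdd P v u))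
  pushout-J3 m n f refl refl =
    g , addRel-pushout (arrJ (J3 m n)) f g (λ b → b , refl) (λ _ → refl)
          (inj₁ (there (here refl))) refl refl
    where
    g : codJ (J3 m n) ⇒ addRel P (map (fun f) (seg (m + n) m n)) (map (fun f) (seg (m + n) 0 m))
    g = record { fun = fun f ; pres = λ
      { _ _ (inj₁ (here refl))         → inj₁ (pres f _ _ (inj₁ (here refl)))
      ; _ _ (inj₁ (there (here refl))) → inj₂ (refl , refl)
      ; _ _ (inj₂ refl)                → inj₁ (isRefl P _) } }

  pushout-J4 : ∀ m n p (f : domJ (J4 m n p) ⇒ P) {u w : List (Gen P)} →
    map (fun f) (seg (m + n + p) 0 m) ≡ u → map (fun f) (seg (m + n + p) (m + n) p) ≡ w →
    Σ (codJ (J4 m n p) ⇒ addRel P u w) (IsPushout (arrJ (J4 m n p)) f (inclAdd P u w))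
  pushout-J4 m n p f refl refl =
    g , addRel-pushout (arrJ (J4 m n p)) f g (λ b → b , refl) (λ _ → refl)
          (inj₁ (there (there (here refl)))) refl refl
    where
    g : codJ (J4 m n p) ⇒ addRel P (map (fun f) (seg (m + n + p) 0 m))
                                   (map (fun f) (seg (m + n + p) (m + n) p))
    g = record { fun = fun f ; pres = λ
      { _ _ (inj₁ (here refl))                 → inj₁ (pres f _ _ (inj₁ (here refl)))
      ; _ _ (inj₁ (there (here refl)))         → inj₁ (pres f _ _ (inj₁ (there (here refl))))
      ; _ _ (inj₁ (there (there (here refl)))) → inj₂ (refl , refl)
      ; _ _ (inj₂ refl)                        → inj₁ (isRefl P _) } }

  pushout-J5 : ∀ m n p q (f : domJ (J5 m n p q) ⇒ P) {v v′ u w : List (Gen P)} →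
    let word = λ s l → map (fun f) (seg (m + n + p + q) s l) in
    word 0 m ≡ v → word m n ≡ v′ → word (m + n) p ≡ u → word (m + n + p) q ≡ w →
    Σ (codJ (J5 m n p q) ⇒ addRel P (u ++ v ++ w) (u ++ v′ ++ w))
      (IsPushout (arrJ (J5 m n p q)) f (inclAdd P (u ++ v ++ w) (u ++ v′ ++ w)))
  pushout-J5 m n p q f refl refl refl refl =
    g , addRel-pushout (arrJ (J5 m n p q)) f g (λ b → b , refl) (λ _ → refl)
          (inj₁ (there (here refl))) (map-++₃ W U W′) (map-++₃ W V W′)
    where
    k : ℕ
    k = m + n + p + q
    U V W W′ : List (Fin k)
    U = seg k 0 m
    V = seg k m n
    W = seg k (m + n) p
    W′ = seg k (m + n + p) q
    map-++₃ : ∀ a b c → map (fun f) (a ++ b ++ c) ≡ map (fun f) a ++ map (fun f) b ++ map (fun f) c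
    map-++₃ a b c = trans (map-++ (fun f) a (b ++ c)) (cong (map (fun f) a ++_) (map-++ (fun f) b c))
    g : codJ (J5 m n p q) ⇒ addRel P (map (fun f) W ++ map (fun f) U ++ map (fun f) W′)
                                     (map (fun f) W ++ map (fun f) V ++ map (fun f) W′)
    g = record { fun = fun f ; pres = λ
      { _ _ (inj₁ (here refl))         → inj₁ (pres f _ _ (inj₁ (here refl)))
      ; _ _ (inj₁ (there (here refl))) → inj₂ (map-++₃ W U W′ , map-++₃ W V W′)
      ; _ _ (inj₂ refl)                → inj₁ (isRefl P _) } }

induced : {A : Set} {rs : List (List A × List A)} {P : RPres} (h : A → Gen P) →
  All (λ (x , y) → Rel P (map h x) (map h y)) rs → ⟨ A ∣ rs ⟩ ⇒ P
induced {P = P} h rels = record { fun = h ; pres = λ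
  { _ _ (inj₁ xy∈rs) → All.lookup rels xy∈rs
  ; x _ (inj₂ refl)  → isRefl P (map h x) } }

toList-fromList-++ : ∀ {a} {A : Set a} (xs ys : List A) →
                     V.toList (V.fromList xs V.++ V.fromList ys) ≡ xs ++ ys
toList-fromList-++ xs ys = trans (toList-++-fromList (V.fromList xs) ys) (cong (_++ ys) (VP.toList∘fromList xs))

map-lookup-fromList : ∀ {a} {A : Set a} (xs : List A) →
                      map (V.lookup (V.fromList xs)) (seg (length xs) 0 (length xs)) ≡ xs
map-lookup-fromList xs = map-lookup-seg-last (V.fromList xs) [] xs (VP.toList∘fromList xs) refl

canonical-pushout : {P : RPres} (ι : JArrow) (f : domJ ι ⇒ P) →
  Σ (Tietze P) λ T → Σ (codJ ι ⇒ applyT P T) (IsPushout (arrJ ι) f (inclT P T))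
canonical-pushout (J1 m) f = tgen (map (fun f) (seg m 0 m)) , pushout-J1 m f refl
canonical-pushout (J2 m) f = trefl (map (fun f) (seg m 0 m)) , pushout-J2 m f refl
canonical-pushout (J3 m n) f = tsym _ _ (pres f _ _ (inj₁ (here refl))) , pushout-J3 m n f refl refl
canonical-pushout (J4 m n p) f =
  ttrans _ _ _ (pres f _ _ (inj₁ (here refl))) (pres f _ _ (inj₁ (there (here refl)))) ,
  pushout-J4 m n p f refl refl
canonical-pushout {P} (J5 m n p q) f =
  tctxt _ _ (pres f _ _ (inj₁ (here refl))) (word (m + n) p) (word (m + n + p) q) ,
  pushout-J5 m n p q f refl refl refl refl
  where
  word : ℕ → ℕ → List (Gen P)
  word s l = map (fun f) (seg (m + n + p + q) s l)

tietze-is-pushout-of-J : (P : RPres) (T : Tietze P) →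
  Σ JArrow λ ι → Σ (domJ ι ⇒ P) λ f → Σ (codJ ι ⇒ applyT P T) (IsPushout (arrJ ι) f (inclT P T))
tietze-is-pushout-of-J P (tgen u) = J1 (length u) , f , pushout-J1 (length u) f (map-lookup-fromList u)
  where
  f : domJ (J1 (length u)) ⇒ P
  f = induced (V.lookup (V.fromList u)) []
tietze-is-pushout-of-J P (trefl u) = J2 (length u) , f , pushout-J2 (length u) f (map-lookup-fromList u)
  where
  f : domJ (J2 (length u)) ⇒ P
  f = induced (V.lookup (V.fromList u)) []
tietze-is-pushout-of-J P (tsym u v u⇒v) =
  J3 (length u) (length v) , f , pushout-J3 (length u) (length v) f u-seg v-seg
  where
  uv : Vec (Gen P) (length u + length v)
  uv = V.fromList u V.++ V.fromList v
  u-seg : map (V.lookup uv) (seg _ 0 (length u)) ≡ u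
  u-seg = map-lookup-seg uv [] u v (toList-fromList-++ u v) refl
  v-seg : map (V.lookup uv) (seg _ (length u) (length v)) ≡ v
  v-seg = map-lookup-seg-last uv u v (toList-fromList-++ u v) refl
  f : domJ (J3 (length u) (length v)) ⇒ P
  f = induced (V.lookup uv) (subst₂ (Rel P) (sym u-seg) (sym v-seg) u⇒v ∷ [])
tietze-is-pushout-of-J P (ttrans u v w u⇒v v⇒w) =
  J4 (length u) (length v) (length w) , f , pushout-J4 (length u) (length v) (length w) f u-seg w-seg
  where
  uvw : Vec (Gen P) (length u + length v + length w)
  uvw = (V.fromList u V.++ V.fromList v) V.++ V.fromList w
  uvw≡[uv]w : V.toList uvw ≡ (u ++ v) ++ w
  uvw≡[uv]w = trans (toList-++-fromList _ w) (cong (_++ w) (toList-fromList-++ u v))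
  uvw≡u[vw] : V.toList uvw ≡ u ++ v ++ w
  uvw≡u[vw] = trans uvw≡[uv]w (++-assoc u v w)
  u-seg : map (V.lookup uvw) (seg _ 0 (length u)) ≡ u
  u-seg = map-lookup-seg uvw [] u (v ++ w) uvw≡u[vw] refl
  v-seg : map (V.lookup uvw) (seg _ (length u) (length v)) ≡ v
  v-seg = map-lookup-seg uvw u v w uvw≡u[vw] refl
  w-seg : map (V.lookup uvw) (seg _ (length u + length v) (length w)) ≡ w
  w-seg = map-lookup-seg-last uvw (u ++ v) w uvw≡[uv]w (sym (length-++ u))
  f : domJ (J4 (length u) (length v) (length w)) ⇒ P
  f = induced (V.lookup uvw)
        (subst₂ (Rel P) (sym u-seg) (sym v-seg) u⇒v ∷ subst₂ (Rel P) (sym v-seg) (sym w-seg) v⇒w ∷ [])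
tietze-is-pushout-of-J P (tctxt v v′ v⇒v′ u w) =
  J5 (length v) (length v′) (length u) (length w) , f ,
  pushout-J5 (length v) (length v′) (length u) (length w) f v-seg v′-seg u-seg w-seg
  where
  vv′uw : Vec (Gen P) (length v + length v′ + length u + length w)
  vv′uw = ((V.fromList v V.++ V.fromList v′) V.++ V.fromList u) V.++ V.fromList w
  vv′uw≡[[vv′]u]w : V.toList vv′uw ≡ ((v ++ v′) ++ u) ++ w
  vv′uw≡[[vv′]u]w = trans (toList-++-fromList _ w)
    (cong (_++ w) (trans (toList-++-fromList _ u) (cong (_++ u) (toList-fromList-++ v v′))))
  vv′uw≡[vv′][uw] : V.toList vv′uw ≡ (v ++ v′) ++ u ++ w
  vv′uw≡[vv′][uw] = trans vv′uw≡[[vv′]u]w (++-assoc (v ++ v′) u w)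
  vv′uw≡v[v′[uw]] : V.toList vv′uw ≡ v ++ v′ ++ u ++ w
  vv′uw≡v[v′[uw]] = trans vv′uw≡[vv′][uw] (++-assoc v v′ (u ++ w))
  v-seg : map (V.lookup vv′uw) (seg _ 0 (length v)) ≡ v
  v-seg = map-lookup-seg vv′uw [] v (v′ ++ u ++ w) vv′uw≡v[v′[uw]] refl
  v′-seg : map (V.lookup vv′uw) (seg _ (length v) (length v′)) ≡ v′
  v′-seg = map-lookup-seg vv′uw v v′ (u ++ w) vv′uw≡v[v′[uw]] refl
  u-seg : map (V.lookup vv′uw) (seg _ (length v + length v′) (length u)) ≡ u
  u-seg = map-lookup-seg vv′uw (v ++ v′) u w vv′uw≡[vv′][uw] (sym (length-++ v))
  w-seg : map (V.lookup vv′uw) (seg _ (length v + length v′ + length u) (length w)) ≡ w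
  w-seg = map-lookup-seg-last vv′uw ((v ++ v′) ++ u) w vv′uw≡[[vv′]u]w
            (sym (trans (length-++ (v ++ v′)) (cong (_+ length u) (length-++ v))))
  f : domJ (J5 (length v) (length v′) (length u) (length w)) ⇒ P
  f = induced (V.lookup vv′uw) (subst₂ (Rel P) (sym v-seg) (sym v′-seg) v⇒v′ ∷ [])

pushout-of-J-is-tietze : (ι : JArrow) (P' : RPres) (f : domJ ι ⇒ P') (Q' : RPres)
  (j' : P' ⇒ Q') (g : codJ ι ⇒ Q') → IsPushout (arrJ ι) f j' g →
  Σ (Tietze P') λ T → Σ (Q' ⇒ applyT P' T) λ φ → IsIso φ × (φ ∘ₚ j' ≈ₚ inclT P' T)
pushout-of-J-is-tietze ι P' f Q' j' g po =
  let T , g′ , po′ = canonical-pushout ι f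
  in T , pushout-unique {j = arrJ ι} {f = f} {j₁ = j'} {g₁ = g} {j₂ = inclT P' T} {g₂ = g′} po po′

mainTheorem12 :
    ((ι : JArrow) (P' : RPres) (f : domJ ι ⇒ P') (Q' : RPres)
       (j' : P' ⇒ Q') (g : codJ ι ⇒ Q') →
       IsPushout (arrJ ι) f j' g →
       Σ (Tietze P') λ T → Σ (Q' ⇒ applyT P' T) λ φ →
         IsIso φ × (φ ∘ₚ j' ≈ₚ inclT P' T))
    ×
    ((P' : RPres) (T : Tietze P') →
       Σ JArrow λ ι → Σ (domJ ι ⇒ P') λ f → Σ (codJ ι ⇒ applyT P' T) λ g →
         IsPushout (arrJ ι) f (inclT P' T) g)
mainTheorem12 = pushout-of-J-is-tietze , tietze-is-pushout-of-J
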